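{- Let $Q,R\subseteq\mathbb{F}_2^n$ and define $Q\bullet R\subseteq\mathbb{F}_2^{n+2}$ by \[Q\bullet R:=\{\mathbf{v}00\mid \mathbf{v}\in Q\cap R\}\cup\{\mathbf{v}01\mid \mathbf{v}\in Q\setminus R\}\cup\{\mathbf{v}10\mid \mathbf{v}\in R\setminus Q\}\cup\{\mathbf{v}11\mid \mathbf{v}\in\mathbb{F}_2^n\setminus(Q\cup R)\},\] where $\mathbf{v}ab$ denotes $\mathbf{v}$ with the bits $a,b$ appended. Then $Q\bullet R$ is a powerful set if and only if $Q$, $R$ and $Q\cap R$ are all powerful sets.
   Context: A set $S\subseteq\mathbb{F}_2^n$ (positions indexed by $[n]$) is a powerful set if for every $X\subseteq[n]$ the number of vectors in $S$ that are zero in all positions of $X$ is a power of $2$. -}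

module Defs where

open import Data.Bool using (Bool; true; false; _∧_; _∨_; not; if_then_else_)
open import Data.Nat using (ℕ; zero; suc; _+_; _^_)
open import Data.Vec using (Vec; []; _∷_; _++_; splitAt; zipWith; foldr)
open import Data.List using (List; []; _∷_; map; filter; length; concatMap; _++_)
open import Data.Product using (∃; _,_)
open import Relation.Binary.PropositionalEquality using (_≡_)
open import Relation.Nullary.Decidable using (Dec)
open import Data.Bool.Properties using (T?)

-- A vector of F₂ⁿ is a Vec Bool n (false = 0, true = 1); positions are Fin n.
-- A subset S ⊆ F₂ⁿ is given by its characteristic function.
SetF2 : ℕ → Set
SetF2 n = Vec Bool n → Bool

allVecs : (n : ℕ) → List (Vec Bool n)
allVecs zero = [] ∷ []
allVecs (suc n) = Data.List._++_ (map (false ∷_) (allVecs n)) (map (true ∷_) (allVecs n))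

-- v is zero on all positions of X (X ⊆ [n] given as a Bool vector / Data.Fin.Subset).
zeroOn : ∀ {n} → Vec Bool n → Vec Bool n → Bool
zeroOn [] [] = true
zeroOn (x ∷ X) (v ∷ w) = (not (x ∧ v)) ∧ zeroOn X w

countZeroOn : ∀ {n} → SetF2 n → Vec Bool n → ℕ
countZeroOn {n} S X = length (filter (λ v → T? (S v ∧ zeroOn X v)) (allVecs n))

IsPowerOf2 : ℕ → Set
IsPowerOf2 m = ∃ λ k → m ≡ 2 ^ k

Powerful : ∀ {n} → SetF2 n → Set
Powerful {n} S = (X : Vec Bool n) → IsPowerOf2 (countZeroOn S X)

_∩_ : ∀ {n} → SetF2 n → SetF2 n → SetF2 n
(Q ∩ R) v = Q v ∧ R v

bulletBits : Bool → Bool → Bool → Bool → Bool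
bulletBits q r false false = q ∧ r
bulletBits q r false true  = q ∧ not r
bulletBits q r true  false = r ∧ not q
bulletBits q r true  true  = not q ∧ not r

_•_ : ∀ {n} → SetF2 n → SetF2 n → SetF2 (n + 2)
_•_ {n} Q R w with splitAt n w
... | v , (a ∷ b ∷ []) , _ = bulletBits (Q v) (R v) a b

-- Split the vectors of F₂ⁿ⁺² by their last two bits. If X ⊆ [n+2] contains neither of the
-- two new positions, all four slices of Q • R survive and together they partition F₂ⁿ, so
-- the count is that of the whole space, always a power of two. Forcing the first new bit to 0
-- leaves the slices Q ∩ R and Q ∖ R, i.e. Q; forcing the second leaves Q ∩ R and R ∖ Q,
-- i.e. R; forcing both leaves Q ∩ R. So the counts of Q • R are exactly the counts of
-- F₂ⁿ, Q, R and Q ∩ R.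
module Submission where

open import Defs

open import Algebra.Properties.CommutativeSemigroup using (interchange)
open import Data.Bool using (Bool; true; false; _∧_; not)
open import Data.Bool.Properties using (T?; ∧-assoc)
open import Data.List using (List; []; _∷_; map; filter; length)
import Data.List as List
open import Data.List.Properties using (map-++; map-∘; map-cong)
open import Data.Nat using (ℕ; zero; suc; _+_; _^_)
open import Data.Nat.ListAction using (sum)
open import Data.Nat.ListAction.Properties using (sum-++)
open import Data.Nat.Properties using (+-identityʳ; +-commutativeSemigroup)
open import Data.Product using (_×_; _,_)
open import Data.Vec using (Vec; []; _∷_; _++_; splitAt)
open import Data.Vec.Properties using (++-injective)
open import Function.Bundles using (_⇔_; mk⇔)
open import Relation.Binary.PropositionalEquality

𝟙 : Bool → ℕ
𝟙 true  = 1
𝟙 false = 0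

∑ : {A : Set} → List A → (A → ℕ) → ℕ
∑ xs f = sum (map f xs)

module _ {A : Set} where

  length-filter-T? : (p : A → Bool) (xs : List A) →
                     length (filter (λ x → T? (p x)) xs) ≡ ∑ xs (λ x → 𝟙 (p x))
  length-filter-T? p []       = refl
  length-filter-T? p (x ∷ xs) with p x
  ... | true  = cong suc (length-filter-T? p xs)
  ... | false = length-filter-T? p xs

  ∑-cong : {f g : A → ℕ} → (∀ x → f x ≡ g x) → (xs : List A) → ∑ xs f ≡ ∑ xs g
  ∑-cong f≗g xs = cong sum (map-cong f≗g xs)

  ∑-++ : (f : A → ℕ) (xs ys : List A) → ∑ (xs List.++ ys) f ≡ ∑ xs f + ∑ ys f
  ∑-++ f xs ys = trans (cong sum (map-++ f xs ys)) (sum-++ (map f xs) (map f ys))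

  ∑-zero : (xs : List A) → ∑ xs (λ _ → 0) ≡ 0
  ∑-zero []       = refl
  ∑-zero (x ∷ xs) = ∑-zero xs

  ∑-+ : (f g : A → ℕ) (xs : List A) → ∑ xs (λ x → f x + g x) ≡ ∑ xs f + ∑ xs g
  ∑-+ f g []       = refl
  ∑-+ f g (x ∷ xs) = trans (cong (f x + g x +_) (∑-+ f g xs))
                           (interchange +-commutativeSemigroup (f x) (g x) (∑ xs f) (∑ xs g))

∑-map : {A B : Set} (f : B → ℕ) (g : A → B) (xs : List A) → ∑ (map g xs) f ≡ ∑ xs (λ x → f (g x))
∑-map f g xs = cong sum (sym (map-∘ xs))

∑-comm : {A B : Set} (f : A → B → ℕ) (xs : List A) (ys : List B) →
         ∑ xs (λ x → ∑ ys (f x)) ≡ ∑ ys (λ y → ∑ xs (λ x → f x y))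
∑-comm f []       ys = sym (∑-zero ys)
∑-comm f (x ∷ xs) ys = trans (cong (∑ ys (f x) +_) (∑-comm f xs ys))
                            (sym (∑-+ (f x) (λ y → ∑ xs (λ x′ → f x′ y)) ys))

∑-allVecs-suc : ∀ n (f : Vec Bool (suc n) → ℕ) →
                ∑ (allVecs (suc n)) f ≡ ∑ (allVecs n) (λ v → f (false ∷ v)) + ∑ (allVecs n) (λ v → f (true ∷ v))
∑-allVecs-suc n f = trans (∑-++ f (map (false ∷_) (allVecs n)) (map (true ∷_) (allVecs n)))
                          (cong₂ _+_ (∑-map f (false ∷_) (allVecs n)) (∑-map f (true ∷_) (allVecs n)))

∑-allVecs-++ : ∀ n m (f : Vec Bool (n + m) → ℕ) →
               ∑ (allVecs (n + m)) f ≡ ∑ (allVecs m) (λ w → ∑ (allVecs n) (λ v → f (v ++ w)))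
∑-allVecs-++ zero    m f = ∑-cong (λ w → sym (+-identityʳ (f w))) (allVecs m)
∑-allVecs-++ (suc n) m f = begin
  ∑ (allVecs (suc n + m)) f
    ≡⟨ ∑-allVecs-suc (n + m) f ⟩
  ∑ (allVecs (n + m)) (λ u → f (false ∷ u)) + ∑ (allVecs (n + m)) (λ u → f (true ∷ u))
    ≡⟨ cong₂ _+_ (∑-allVecs-++ n m (λ u → f (false ∷ u))) (∑-allVecs-++ n m (λ u → f (true ∷ u))) ⟩
  ∑ (allVecs m) (λ w → ∑ (allVecs n) (λ v → f (false ∷ v ++ w)))
    + ∑ (allVecs m) (λ w → ∑ (allVecs n) (λ v → f (true ∷ v ++ w)))
    ≡⟨ sym (∑-+ _ _ (allVecs m)) ⟩
  ∑ (allVecs m) (λ w → ∑ (allVecs n) (λ v → f (false ∷ v ++ w)) + ∑ (allVecs n) (λ v → f (true ∷ v ++ w)))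
    ≡⟨ ∑-cong (λ w → sym (∑-allVecs-suc n (λ v → f (v ++ w)))) (allVecs m) ⟩
  ∑ (allVecs m) (λ w → ∑ (allVecs (suc n)) (λ v → f (v ++ w)))
    ∎
  where open ≡-Reasoning

countZeroOn-∑ : ∀ {n} (S : SetF2 n) (X : Vec Bool n) →
                countZeroOn S X ≡ ∑ (allVecs n) (λ v → 𝟙 (S v ∧ zeroOn X v))
countZeroOn-∑ {n} S X = length-filter-T? (λ v → S v ∧ zeroOn X v) (allVecs n)

zeroOn-++ : ∀ {n m} (X v : Vec Bool n) (Y w : Vec Bool m) →
            zeroOn (X ++ Y) (v ++ w) ≡ zeroOn X v ∧ zeroOn Y w
zeroOn-++ []      []      Y w = refl
zeroOn-++ (x ∷ X) (y ∷ v) Y w = trans (cong (not (x ∧ y) ∧_) (zeroOn-++ X v Y w))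
                                      (sym (∧-assoc (not (x ∧ y)) (zeroOn X v) (zeroOn Y w)))

∑-zeroOn-powerOf2 : ∀ {n} (X : Vec Bool n) → IsPowerOf2 (∑ (allVecs n) (λ v → 𝟙 (zeroOn X v)))
∑-zeroOn-powerOf2 []            = 0 , refl
∑-zeroOn-powerOf2 {suc n} (false ∷ X) with ∑-zeroOn-powerOf2 X
... | k , c≡2^k = suc k , (begin
  ∑ (allVecs (suc n)) (λ v → 𝟙 (zeroOn (false ∷ X) v)) ≡⟨ ∑-allVecs-suc n _ ⟩
  c + c                                                ≡⟨ cong₂ _+_ c≡2^k c≡2^k ⟩
  2 ^ k + 2 ^ k                                        ≡⟨ cong (2 ^ k +_) (sym (+-identityʳ (2 ^ k))) ⟩
  2 ^ suc k                                            ∎)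
  where
  open ≡-Reasoning
  c : ℕ
  c = ∑ (allVecs n) (λ v → 𝟙 (zeroOn X v))
∑-zeroOn-powerOf2 {suc n} (true ∷ X) with ∑-zeroOn-powerOf2 X
... | k , c≡2^k = k , (begin
  ∑ (allVecs (suc n)) (λ v → 𝟙 (zeroOn (true ∷ X) v)) ≡⟨ ∑-allVecs-suc n _ ⟩
  c + ∑ (allVecs n) (λ _ → 0)                         ≡⟨ cong (c +_) (∑-zero (allVecs n)) ⟩
  c + 0                                               ≡⟨ +-identityʳ c ⟩
  c                                                   ≡⟨ c≡2^k ⟩
  2 ^ k                                               ∎)
  where
  open ≡-Reasoning
  c : ℕ
  c = ∑ (allVecs n) (λ v → 𝟙 (zeroOn X v))

full-powerful : ∀ {n} → Powerful {n} (λ _ → true)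
full-powerful X = subst IsPowerOf2 (sym (countZeroOn-∑ (λ _ → true) X)) (∑-zeroOn-powerOf2 X)

•-++ : ∀ {n} (Q R : SetF2 n) (v : Vec Bool n) (a b : Bool) →
       (Q • R) (v ++ a ∷ b ∷ []) ≡ bulletBits (Q v) (R v) a b
•-++ {n} Q R v a b with splitAt n (v ++ a ∷ b ∷ [])
... | v′ , a′ ∷ b′ ∷ [] , eq with ++-injective v v′ eq
... | refl , refl = refl

-- What is left of Q • R in F₂ⁿ once the last two bits are forced to 0 wherever xa, xb are set.
sliceBits : (xa xb q r : Bool) → Bool
sliceBits false false q r = true
sliceBits true  false q r = q
sliceBits false true  q r = r
sliceBits true  true  q r = q ∧ r

slice : ∀ {n} (xa xb : Bool) → SetF2 n → SetF2 n → SetF2 n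
slice xa xb Q R v = sliceBits xa xb (Q v) (R v)

bulletBits-slice : ∀ xa xb q r z →
  let term a b = 𝟙 (bulletBits q r a b ∧ (z ∧ zeroOn (xa ∷ xb ∷ []) (a ∷ b ∷ [])))
  in term false false + (term false true + (term true false + (term true true + 0)))
       ≡ 𝟙 (sliceBits xa xb q r ∧ z)
bulletBits-slice false false false false false = refl
bulletBits-slice false false false false true  = refl
bulletBits-slice false false false true  false = refl
bulletBits-slice false false false true  true  = refl
bulletBits-slice false false true  false false = refl
bulletBits-slice false false true  false true  = refl
bulletBits-slice false false true  true  false = refl
bulletBits-slice false false true  true  true  = refl
bulletBits-slice false true  false false false = refl
bulletBits-slice false true  false false true  = refl
bulletBits-slice false true  false true  false = refl
bulletBits-slice false true  false true  true  = refl
bulletBits-slice false true  true  false false = refl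
bulletBits-slice false true  true  false true  = refl
bulletBits-slice false true  true  true  false = refl
bulletBits-slice false true  true  true  true  = refl
bulletBits-slice true  false false false false = refl
bulletBits-slice true  false false false true  = refl
bulletBits-slice true  false false true  false = refl
bulletBits-slice true  false false true  true  = refl
bulletBits-slice true  false true  false false = refl
bulletBits-slice true  false true  false true  = refl
bulletBits-slice true  false true  true  false = refl
bulletBits-slice true  false true  true  true  = refl
bulletBits-slice true  true  false false false = refl
bulletBits-slice true  true  false false true  = refl
bulletBits-slice true  true  false true  false = refl
bulletBits-slice true  true  false true  true  = refl
bulletBits-slice true  true  true  false false = refl
bulletBits-slice true  true  true  false true  = refl
bulletBits-slice true  true  true  true  false = refl
bulletBits-slice true  true  true  true  true  = refl

countZeroOn-• : ∀ {n} (Q R : SetF2 n) (X : Vec Bool n) (xa xb : Bool) →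
                countZeroOn (Q • R) (X ++ xa ∷ xb ∷ []) ≡ countZeroOn (slice xa xb Q R) X
countZeroOn-• {n} Q R X xa xb = begin
  countZeroOn (Q • R) (X ++ x)
    ≡⟨ countZeroOn-∑ (Q • R) (X ++ x) ⟩
  ∑ (allVecs (n + 2)) count•
    ≡⟨ ∑-allVecs-++ n 2 count• ⟩
  ∑ (allVecs 2) (λ w → ∑ (allVecs n) (λ v → count• (v ++ w)))
    ≡⟨ sym (∑-comm (λ v w → count• (v ++ w)) (allVecs n) (allVecs 2)) ⟩
  ∑ (allVecs n) (λ v → ∑ (allVecs 2) (λ w → count• (v ++ w)))
    ≡⟨ ∑-cong slice-count (allVecs n) ⟩
  ∑ (allVecs n) (λ v → 𝟙 (slice xa xb Q R v ∧ zeroOn X v))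
    ≡⟨ sym (countZeroOn-∑ (slice xa xb Q R) X) ⟩
  countZeroOn (slice xa xb Q R) X
    ∎
  where
  open ≡-Reasoning
  x : Vec Bool 2
  x = xa ∷ xb ∷ []

  count• : Vec Bool (n + 2) → ℕ
  count• u = 𝟙 ((Q • R) u ∧ zeroOn (X ++ x) u)

  slice-count : ∀ v → ∑ (allVecs 2) (λ w → count• (v ++ w)) ≡ 𝟙 (slice xa xb Q R v ∧ zeroOn X v)
  slice-count v = trans (∑-cong term≡ (allVecs 2)) (bulletBits-slice xa xb (Q v) (R v) (zeroOn X v))
    where
    term : Vec Bool 2 → ℕ
    term (a ∷ b ∷ []) = 𝟙 (bulletBits (Q v) (R v) a b ∧ (zeroOn X v ∧ zeroOn x (a ∷ b ∷ [])))

    term≡ : ∀ w → count• (v ++ w) ≡ term w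
    term≡ (a ∷ b ∷ []) = cong 𝟙 (cong₂ _∧_ (•-++ Q R v a b) (zeroOn-++ X v x (a ∷ b ∷ [])))

slice-powerful : ∀ {n} {Q R : SetF2 n} → Powerful Q → Powerful R → Powerful (Q ∩ R) →
                 ∀ xa xb → Powerful (slice xa xb Q R)
slice-powerful pQ pR pQ∩R false false = full-powerful
slice-powerful pQ pR pQ∩R true  false = pQ
slice-powerful pQ pR pQ∩R false true  = pR
slice-powerful pQ pR pQ∩R true  true  = pQ∩R

theorem11 : (n : ℕ) (Q R : SetF2 n) →
    Powerful (Q • R) ⇔ (Powerful Q × Powerful R × Powerful (Q ∩ R))
theorem11 n Q R = mk⇔ slices-powerful •-powerful
  where
  slice-of-• : Powerful (Q • R) → ∀ xa xb → Powerful (slice xa xb Q R)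
  slice-of-• p xa xb X = subst IsPowerOf2 (countZeroOn-• Q R X xa xb) (p (X ++ xa ∷ xb ∷ []))

  slices-powerful : Powerful (Q • R) → Powerful Q × Powerful R × Powerful (Q ∩ R)
  slices-powerful p = slice-of-• p true false , slice-of-• p false true , slice-of-• p true true

  •-powerful : Powerful Q × Powerful R × Powerful (Q ∩ R) → Powerful (Q • R)
  •-powerful (pQ , pR , pQ∩R) X with splitAt n X
  ... | X′ , xa ∷ xb ∷ [] , refl =
    subst IsPowerOf2 (sym (countZeroOn-• Q R X′ xa xb)) (slice-powerful pQ pR pQ∩R xa xb X′)
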